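{- Let $U$ be a regular subgroup of $G$ and $C$ a decisive and $U$-consistent social preference correspondence. Then $C$ admits a $U$-consistent resolute refinement.
   Context: Let $n,h\ge 2$ be integers, $N=\{1,\dots,n\}$, $H=\{1,\dots,h\}$. $S_m$ is the symmetric group on $\{1,\dots,m\}$ with product $(\sigma\tau)(x)=\sigma(\tau(x))$. $\mathbf L(N)$ is the set of linear orders on $N$; a linear order $q$ with $q(1)\succ\dots\succ q(n)$ is identified with the permutation $r\mapsto q(r)$ in $S_n$. Let $\rho_0(r)=n-r+1$, $\Omega=\{id,\rho_0\}\le S_n$. $\mathcal P=\mathbf L(N)^h$. $G=S_h\times S_n\times\Omega$; $p^{(\varphi,\psi,\rho)}$ is the profile with $i$-th component $\psi p_{\varphi^{ -1}(i)}\rho$; $\mathrm{Stab}_U(p)=\{g\in U:p^g=p\}$. $U\le G$ is regular if for every $p\in\mathcal P$ there is $\psi_*\in S_n$ conjugate to $\rho_0$ with $\mathrm{Stab}_U(p)\subseteq(S_h\times\{id\}\times\{id\})\cup(S_h\times\{\psi_*\}\times\{\rho_0\})$. A social preference correspondence assigns to each $p$ a subset $C(p)\subseteq\mathbf L(N)$; decisive: $C(p)\ne\emptyset$ always; resolute: $|C(p)|=1$ always; $C'$ refines $C$ if $C'(p)\subseteq C(p)$ for all $p$. For a set $X$ of linear orders and $\psi\in S_n$, $\psi X=\{\psi q:q\in X\}$. $C$ is $U$-consistent if for all $p$ and $(\varphi,\psi,\rho)\in U$: $C(p^{(\varphi,\psi,\rho)})=\psi C(p)$ if $\rho=id$, and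 $C(p^{(\varphi,\psi,\rho)})\ne\psi C(p)$ if $\rho=\rho_0$ and $|C(p)|=1$. -}

module Defs where

open import Data.Nat using (ℕ; _≥_)
open import Data.Fin using (Fin; opposite; _≟_)
open import Data.Fin.Properties using (all?; opposite-involutive)
open import Data.Vec using (Vec; lookup; tabulate; allFin)
open import Data.Vec.Properties using (lookup∘tabulate)
open import Data.Bool using (Bool; true; false; T; _xor_)
open import Data.Product using (Σ; ∃; _×_; _,_; proj₁; proj₂)
open import Data.Sum using (_⊎_)
open import Relation.Nullary using (¬_; Dec)
open import Relation.Nullary.Decidable using (True; toWitness; fromWitness; _×-dec_)
open import Relation.Binary.PropositionalEquality using (_≡_; refl; trans; cong; sym)

-- Permutations of Fin m, stored as a pair of vectors (forward map and
-- inverse map) together with a (proof-irrelevant, Bool-checked) witness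
-- that they are mutually inverse.  With this representation propositional
-- equality _≡_ on permutations is the right (extensional) equality.

Inv : {m : ℕ} → Vec (Fin m) m → Vec (Fin m) m → Set
Inv f g = (∀ i → lookup f (lookup g i) ≡ i) × (∀ i → lookup g (lookup f i) ≡ i)

inv? : {m : ℕ} → (f g : Vec (Fin m) m) → Dec (Inv f g)
inv? f g = all? (λ i → lookup f (lookup g i) ≟ i) ×-dec all? (λ i → lookup g (lookup f i) ≟ i)

record Perm (m : ℕ) : Set where
  constructor perm
  field
    fwd : Vec (Fin m) m
    bwd : Vec (Fin m) m
    ok  : True (inv? fwd bwd)
open Perm public

app : {m : ℕ} → Perm m → Fin m → Fin m
app σ x = lookup (fwd σ) x

app⁻ : {m : ℕ} → Perm m → Fin m → Fin m
app⁻ σ x = lookup (bwd σ) x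

private
  inv-of : {m : ℕ} (σ : Perm m) → Inv (fwd σ) (bwd σ)
  inv-of σ = toWitness (ok σ)

  lt : {m : ℕ} (f : Fin m → Fin m) (i : Fin m) → lookup (tabulate f) i ≡ f i
  lt f i = lookup∘tabulate f i

_∘ₚ_ : {m : ℕ} → Perm m → Perm m → Perm m
_∘ₚ_ {m} σ τ = perm F B (fromWitness (l , r))
  where
  F = tabulate (λ i → app σ (app τ i))
  B = tabulate (λ i → app⁻ τ (app⁻ σ i))
  l : ∀ i → lookup F (lookup B i) ≡ i
  l i rewrite lt (λ i → app⁻ τ (app⁻ σ i)) i
            | lt (λ i → app σ (app τ i)) (app⁻ τ (app⁻ σ i))
            | proj₁ (inv-of τ) (app⁻ σ i) = proj₁ (inv-of σ) i
  r : ∀ i → lookup B (lookup F i) ≡ i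
  r i rewrite lt (λ i → app σ (app τ i)) i
            | lt (λ i → app⁻ τ (app⁻ σ i)) (app σ (app τ i))
            | proj₂ (inv-of σ) (app τ i) = proj₂ (inv-of τ) i

infixr 9 _∘ₚ_

idₚ : {m : ℕ} → Perm m
idₚ {m} = perm (allFin m) (allFin m)
  (fromWitness ((λ i → trans (cong (lookup (allFin m)) (lt (λ x → x) i)) (lt (λ x → x) i))
              , (λ i → trans (cong (lookup (allFin m)) (lt (λ x → x) i)) (lt (λ x → x) i))))

_⁻¹ₚ : {m : ℕ} → Perm m → Perm m
σ ⁻¹ₚ = perm (bwd σ) (fwd σ) (fromWitness (proj₂ (toWitness (ok σ)) , proj₁ (toWitness (ok σ))))

-- ρ₀(r) = n - r + 1 ; with 0-indexed Fin this is `opposite`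
ρ₀ : {m : ℕ} → Perm m
ρ₀ {m} = perm O O (fromWitness (e , e))
  where
  O = tabulate opposite
  e : ∀ i → lookup O (lookup O i) ≡ i
  e i rewrite lt opposite i | lt opposite (opposite i) = opposite-involutive i

-- a linear order q with q(1) ≻ … ≻ q(n) is identified with r ↦ q(r)
LinOrd : ℕ → Set
LinOrd n = Perm n

Profile : ℕ → ℕ → Set
Profile n h = Vec (LinOrd n) h

-- Ω = {id, ρ₀} ≅ Bool  (false ↦ id, true ↦ ρ₀); composition is xor
Ωval : {n : ℕ} → Bool → Perm n
Ωval false = idₚ
Ωval true  = ρ₀

record GElt (n h : ℕ) : Set where
  constructor gelt
  field
    φ : Perm h
    ψ : Perm n
    ρ : Bool
open GElt public

_·G_ : {n h : ℕ} → GElt n h → GElt n h → GElt n h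
gelt φ ψ ρ ·G gelt φ' ψ' ρ' = gelt (φ ∘ₚ φ') (ψ ∘ₚ ψ') (ρ xor ρ')

eG : {n h : ℕ} → GElt n h
eG = gelt idₚ idₚ false

invG : {n h : ℕ} → GElt n h → GElt n h
invG (gelt φ ψ ρ) = gelt (φ ⁻¹ₚ) (ψ ⁻¹ₚ) ρ

act : {n h : ℕ} → Profile n h → GElt n h → Profile n h
act p (gelt φ ψ ρ) = tabulate (λ i → ψ ∘ₚ lookup p (app⁻ φ i) ∘ₚ Ωval ρ)

-- subgroups of G, as (decidable) subsets of the finite group G
record IsSubgroup {n h : ℕ} (U : GElt n h → Bool) : Set where
  field
    has-e   : T (U eG)
    closed· : ∀ g g' → T (U g) → T (U g') → T (U (g ·G g'))
    closed⁻ : ∀ g → T (U g) → T (U (invG g))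

ConjToρ₀ : {n : ℕ} → Perm n → Set
ConjToρ₀ {n} ψ = Σ (Perm n) λ σ → ψ ≡ σ ∘ₚ ρ₀ ∘ₚ (σ ⁻¹ₚ)

Regular : {n h : ℕ} → (GElt n h → Bool) → Set
Regular {n} {h} U =
  (p : Profile n h) → Σ (Perm n) λ ψ* → ConjToρ₀ ψ* ×
    ((g : GElt n h) → T (U g) → act p g ≡ p →
       (ψ g ≡ idₚ × ρ g ≡ false) ⊎ (ψ g ≡ ψ* × ρ g ≡ true))

-- Social preference correspondences: C(p) ⊆ L(N), as a subset of the
-- finite set L(N) (characteristic function).

SPC : ℕ → ℕ → Set
SPC n h = Profile n h → LinOrd n → Bool

_∈C_ : {n : ℕ} → LinOrd n → (LinOrd n → Bool) → Set
q ∈C X = T (X q)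

_≐_ : {n : ℕ} → (X Y : LinOrd n → Set) → Set
X ≐ Y = ∀ q → (X q → Y q) × (Y q → X q)

imageBy : {n : ℕ} → Perm n → (LinOrd n → Bool) → LinOrd n → Set
imageBy ψ X q = Σ _ λ q' → q' ∈C X × q ≡ ψ ∘ₚ q'

Singleton : {n : ℕ} → (LinOrd n → Bool) → Set
Singleton X = Σ _ λ q → q ∈C X × (∀ q' → q' ∈C X → q' ≡ q)

Decisive : {n h : ℕ} → SPC n h → Set
Decisive C = ∀ p → Σ _ λ q → q ∈C C p

Resolute : {n h : ℕ} → SPC n h → Set
Resolute C = ∀ p → Singleton (C p)

Refines : {n h : ℕ} → SPC n h → SPC n h → Set
Refines C' C = ∀ p q → q ∈C C' p → q ∈C C p

Consistent : {n h : ℕ} → (GElt n h → Bool) → SPC n h → Set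
Consistent {n} {h} U C = (p : Profile n h) (g : GElt n h) → T (U g) →
  (ρ g ≡ false → (λ q → q ∈C C (act p g)) ≐ imageBy (ψ g) (C p)) ×
  (ρ g ≡ true → Singleton (C p) → ¬ ((λ q → q ∈C C (act p g)) ≐ imageBy (ψ g) (C p)))

-- Call g ∈ U even if ρ g = id and odd otherwise.  Every U-orbit gets a canonical
-- representative r (its first member in a fixed enumeration of profiles), and at r
-- an anchor: distinct orders `even` ∈ C(r) and `odd` such that ψ_g(odd) ∈ C(r^g)
-- for odd g ∈ U and ψ_z(even) = odd for odd stabilisers z of r.  The refinement
-- selects at p = r^g the order ψ_g(even) or ψ_g(odd) according to the sign of g.
-- Regularity makes this independent of g, U-consistency of C on even elements
-- puts it in C(p), and since even ≠ odd it is equivariant along even and never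
-- along odd elements of U.  Anchors exist: take odd = ψ_x(even) for an odd
-- stabiliser x of r; failing that, the ρ₀-half of consistency of C at (r, t) for
-- an odd t ∈ U gives a ∈ C(r), b ∈ C(r^t) with b ≠ ψ_t a; with no odd elements
-- any order distinct from even serves.
module Submission where

open import Defs
open import Level using (0ℓ)
open import Algebra.Bundles using (Group)
import Algebra.Properties.Group
open import Data.Nat using (ℕ; _≥_; zero; suc; s≤s)
open import Data.Fin using (Fin; opposite) renaming (zero to fzero; _≟_ to _≟ᶠ_)
open import Data.Fin.Properties using (opposite-involutive)
open import Data.Vec using (Vec; lookup; []; _∷_)
open import Data.Vec.Properties using (lookup∘tabulate; ≡-dec; tabulate-cong; tabulate∘lookup)
open import Data.Bool using (Bool; true; false; not; T; _xor_; if_then_else_)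
open import Data.Bool.Properties using (T?; T-irrelevant; xor-comm; xor-same; xor-assoc; xor-identityʳ) renaming (_≟_ to _≟ᵇ_)
open import Data.Product using (Σ; ∃; _×_; _,_; proj₁; proj₂)
open import Data.Sum using (inj₁; inj₂)
open import Relation.Nullary using (¬_; Dec; yes; no; contradiction)
open import Relation.Nullary.Decidable using (toWitness; fromWitness; map′; ⌊_⌋; _×-dec_; ¬?; decidable-stable)
open import Data.List using (List; []; _∷_; map; cartesianProduct; cartesianProductWith; allFin)
open import Data.List.Membership.Propositional using (_∈_; lose)
open import Data.List.Membership.Propositional.Properties using (∈-map⁺; ∈-cartesianProduct⁺; ∈-cartesianProductWith⁺; ∈-allFin)
open import Data.List.Relation.Unary.Any using (here; there; any?; satisfied)
open import Data.Empty using (⊥-elim)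
open import Function using (_∘_)
open import Relation.Unary using (Decidable)
open import Relation.Binary.PropositionalEquality

vec-ext : {A : Set} {k : ℕ} {u v : Vec A k} → (∀ i → lookup u i ≡ lookup v i) → u ≡ v
vec-ext {u = u} {v} u≗v =
  trans (sym (tabulate∘lookup u)) (trans (tabulate-cong u≗v) (tabulate∘lookup v))

module _ {m : ℕ} where

  -- A permutation is determined by its forward map: the inverse table and the
  -- (proof-irrelevant) witness are then forced.
  perm-ext : {σ τ : Perm m} → (∀ i → app σ i ≡ app τ i) → σ ≡ τ
  perm-ext {σ} {τ} σ≗τ = same-tables (vec-ext σ≗τ) (vec-ext bwd≗)
    where
    same-tables : {σ τ : Perm m} → fwd σ ≡ fwd τ → bwd σ ≡ bwd τ → σ ≡ τ
    same-tables {perm f g w} {perm .f .g w'} refl refl = cong (perm f g) (T-irrelevant w w')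
    bwd≗ : ∀ i → app⁻ σ i ≡ app⁻ τ i
    bwd≗ i = begin
      app⁻ σ i                 ≡⟨ proj₂ (toWitness (ok τ)) (app⁻ σ i) ⟨
      app⁻ τ (app τ (app⁻ σ i)) ≡⟨ cong (app⁻ τ) (σ≗τ (app⁻ σ i)) ⟨
      app⁻ τ (app σ (app⁻ σ i)) ≡⟨ cong (app⁻ τ) (proj₁ (toWitness (ok σ)) i) ⟩
      app⁻ τ i                 ∎
      where open ≡-Reasoning

  app-∘ : (σ τ : Perm m) (i : Fin m) → app (σ ∘ₚ τ) i ≡ app σ (app τ i)
  app-∘ σ τ = lookup∘tabulate _

  app-id : (i : Fin m) → app (idₚ {m}) i ≡ i
  app-id = lookup∘tabulate _

  ∘ₚ-assoc : (σ τ υ : Perm m) → (σ ∘ₚ τ) ∘ₚ υ ≡ σ ∘ₚ (τ ∘ₚ υ)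
  ∘ₚ-assoc σ τ υ = perm-ext λ i → begin
    app ((σ ∘ₚ τ) ∘ₚ υ) i   ≡⟨ app-∘ (σ ∘ₚ τ) υ i ⟩
    app (σ ∘ₚ τ) (app υ i)  ≡⟨ app-∘ σ τ (app υ i) ⟩
    app σ (app τ (app υ i)) ≡⟨ cong (app σ) (app-∘ τ υ i) ⟨
    app σ (app (τ ∘ₚ υ) i)  ≡⟨ app-∘ σ (τ ∘ₚ υ) i ⟨
    app (σ ∘ₚ (τ ∘ₚ υ)) i   ∎
    where open ≡-Reasoning

  ∘ₚ-identityˡ : (σ : Perm m) → idₚ ∘ₚ σ ≡ σ
  ∘ₚ-identityˡ σ = perm-ext λ i → trans (app-∘ idₚ σ i) (app-id (app σ i))

  ∘ₚ-identityʳ : (σ : Perm m) → σ ∘ₚ idₚ ≡ σ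
  ∘ₚ-identityʳ σ = perm-ext λ i → trans (app-∘ σ idₚ i) (cong (app σ) (app-id i))

  ∘ₚ-inverseˡ : (σ : Perm m) → σ ⁻¹ₚ ∘ₚ σ ≡ idₚ
  ∘ₚ-inverseˡ σ = perm-ext λ i →
    trans (app-∘ (σ ⁻¹ₚ) σ i) (trans (proj₂ (toWitness (ok σ)) i) (sym (app-id i)))

  ∘ₚ-inverseʳ : (σ : Perm m) → σ ∘ₚ σ ⁻¹ₚ ≡ idₚ
  ∘ₚ-inverseʳ σ = perm-ext λ i →
    trans (app-∘ σ (σ ⁻¹ₚ) i) (trans (proj₁ (toWitness (ok σ)) i) (sym (app-id i)))

-- The symmetric group S_m, so that the library's derived group laws apply.
Sym : ℕ → Group 0ℓ 0ℓ
Sym m = record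
  { Carrier = Perm m ; _≈_ = _≡_ ; _∙_ = _∘ₚ_ ; ε = idₚ ; _⁻¹ = _⁻¹ₚ
  ; isGroup = record
    { isMonoid = record
      { isSemigroup = record
        { isMagma = record { isEquivalence = isEquivalence ; ∙-cong = cong₂ _∘ₚ_ }
        ; assoc = ∘ₚ-assoc }
      ; identity = ∘ₚ-identityˡ , ∘ₚ-identityʳ }
    ; inverse = ∘ₚ-inverseˡ , ∘ₚ-inverseʳ
    ; ⁻¹-cong = cong _⁻¹ₚ } }

module SymProperties {m : ℕ} = Algebra.Properties.Group (Sym m)
open SymProperties using (∙-cancelˡ; ∙-cancelʳ; \\-leftDividesˡ; inverseʳ-unique)

module _ {m : ℕ} where

  infix 4 _≟ₚ_
  _≟ₚ_ : (σ τ : Perm m) → Dec (σ ≡ τ)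
  σ ≟ₚ τ = map′ (λ e → perm-ext λ i → cong (λ v → lookup v i) e) (cong fwd)
                (≡-dec _≟ᶠ_ (fwd σ) (fwd τ))

  fixes⇒id : {σ : Perm m} (q : Perm m) → σ ∘ₚ q ≡ q → σ ≡ idₚ
  fixes⇒id {σ} q σq≡q = ∙-cancelʳ q σ idₚ (trans σq≡q (sym (∘ₚ-identityˡ q)))

  ρ₀-involutive : ρ₀ {m} ∘ₚ ρ₀ ≡ idₚ
  ρ₀-involutive = perm-ext λ i → begin
    app (ρ₀ ∘ₚ ρ₀) i         ≡⟨ app-∘ ρ₀ ρ₀ i ⟩
    app ρ₀ (app ρ₀ i)        ≡⟨ lookup∘tabulate opposite (app ρ₀ i) ⟩
    opposite (app ρ₀ i)      ≡⟨ cong opposite (lookup∘tabulate opposite i) ⟩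
    opposite (opposite i)    ≡⟨ opposite-involutive i ⟩
    i                        ≡⟨ app-id i ⟨
    app idₚ i                ∎
    where open ≡-Reasoning

  Ωval-xor : (a b : Bool) → Ωval {m} (a xor b) ≡ Ωval a ∘ₚ Ωval b
  Ωval-xor false b     = sym (∘ₚ-identityˡ (Ωval b))
  Ωval-xor true  false = sym (∘ₚ-identityʳ ρ₀)
  Ωval-xor true  true  = sym ρ₀-involutive

ρ₀≢id : {m : ℕ} → m ≥ 2 → ρ₀ {m} ≢ idₚ
ρ₀≢id {suc (suc k)} _ ρ₀≡id with cong (λ σ → app σ fzero) ρ₀≡id
... | ()
ρ₀≢id {suc zero} (s≤s ())

conj-ρ₀≢id : {m : ℕ} → m ≥ 2 → {ψ : Perm m} → ConjToρ₀ ψ → ψ ≢ idₚ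
conj-ρ₀≢id m≥2 (σ , refl) σρ₀σ⁻¹≡id = ρ₀≢id m≥2 (∙-cancelʳ (σ ⁻¹ₚ) ρ₀ idₚ (begin
  ρ₀ ∘ₚ σ ⁻¹ₚ   ≡⟨ inverseʳ-unique σ (ρ₀ ∘ₚ σ ⁻¹ₚ) σρ₀σ⁻¹≡id ⟩
  σ ⁻¹ₚ         ≡⟨ ∘ₚ-identityˡ (σ ⁻¹ₚ) ⟨
  idₚ ∘ₚ σ ⁻¹ₚ  ∎))
  where open ≡-Reasoning

module _ {n h : ℕ} where

  act-lookup : (p : Profile n h) (g : GElt n h) (i : Fin h) →
    lookup (act p g) i ≡ ψ g ∘ₚ lookup p (app⁻ (φ g) i) ∘ₚ Ωval (ρ g)
  act-lookup p g = lookup∘tabulate _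

  act-act : (p : Profile n h) (g g' : GElt n h) → act (act p g) g' ≡ act p (g' ·G g)
  act-act p g@(gelt φ ψ ρ) g'@(gelt φ' ψ' ρ') = vec-ext λ i → begin
    lookup (act (act p g) g') i
      ≡⟨ act-lookup (act p g) g' i ⟩
    ψ' ∘ₚ lookup (act p g) (app⁻ φ' i) ∘ₚ Ωval ρ'
      ≡⟨ cong (λ σ → ψ' ∘ₚ σ ∘ₚ Ωval ρ') (act-lookup p g (app⁻ φ' i)) ⟩
    ψ' ∘ₚ (ψ ∘ₚ entry i ∘ₚ Ωval ρ) ∘ₚ Ωval ρ'
      ≡⟨ cong (ψ' ∘ₚ_) (∘ₚ-assoc ψ (entry i ∘ₚ Ωval ρ) (Ωval ρ')) ⟩
    ψ' ∘ₚ ψ ∘ₚ (entry i ∘ₚ Ωval ρ) ∘ₚ Ωval ρ'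
      ≡⟨ ∘ₚ-assoc ψ' ψ _ ⟨
    (ψ' ∘ₚ ψ) ∘ₚ (entry i ∘ₚ Ωval ρ) ∘ₚ Ωval ρ'
      ≡⟨ cong ((ψ' ∘ₚ ψ) ∘ₚ_) (∘ₚ-assoc (entry i) (Ωval ρ) (Ωval ρ')) ⟩
    (ψ' ∘ₚ ψ) ∘ₚ entry i ∘ₚ Ωval ρ ∘ₚ Ωval ρ'
      ≡⟨ cong₂ (λ j ω → (ψ' ∘ₚ ψ) ∘ₚ lookup p j ∘ₚ ω)
               (lookup∘tabulate _ i) (trans (cong Ωval (xor-comm ρ' ρ)) (Ωval-xor ρ ρ')) ⟨
    (ψ' ∘ₚ ψ) ∘ₚ lookup p (app⁻ (φ' ∘ₚ φ) i) ∘ₚ Ωval (ρ' xor ρ)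
      ≡⟨ act-lookup p (g' ·G g) i ⟨
    lookup (act p (g' ·G g)) i ∎
    where
    open ≡-Reasoning
    entry : Fin h → Perm n
    entry j = lookup p (app⁻ φ (app⁻ φ' j))

  act-identity : (p : Profile n h) → act p eG ≡ p
  act-identity p = vec-ext λ i → begin
    lookup (act p eG) i                  ≡⟨ act-lookup p eG i ⟩
    idₚ ∘ₚ lookup p (app⁻ idₚ i) ∘ₚ idₚ  ≡⟨ ∘ₚ-identityˡ _ ⟩
    lookup p (app⁻ idₚ i) ∘ₚ idₚ         ≡⟨ ∘ₚ-identityʳ _ ⟩
    lookup p (app⁻ idₚ i)                ≡⟨ cong (lookup p) (lookup∘tabulate _ i) ⟩
    lookup p i                           ∎
    where open ≡-Reasoning

  act-inverse : (p : Profile n h) (g : GElt n h) → act (act p g) (invG g) ≡ p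
  act-inverse p g = begin
    act (act p g) (invG g)   ≡⟨ act-act p g (invG g) ⟩
    act p (invG g ·G g)      ≡⟨ cong (act p) g⁻¹g≡e ⟩
    act p eG                 ≡⟨ act-identity p ⟩
    p                        ∎
    where
    open ≡-Reasoning
    g⁻¹g≡e : invG g ·G g ≡ eG
    g⁻¹g≡e = trans (cong₂ (λ σ τ → gelt σ τ (ρ g xor ρ g)) (∘ₚ-inverseˡ (φ g)) (∘ₚ-inverseˡ (ψ g)))
                   (cong (gelt idₚ idₚ) (xor-same (ρ g)))

record Enumeration (A : Set) : Set where
  field
    elements : List A
    complete : ∀ x → x ∈ elements
open Enumeration

module _ {A : Set} (E : Enumeration A) where

  search : {P : A → Set} → Decidable P → Dec (∃ P)
  search P? = map′ satisfied (λ (x , px) → lose (complete E x) px) (any? P? (elements E))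

-- The first element of a list satisfying P, or d if there is none.  Because the
-- choice depends only on the extension of P, it gives canonical representatives.
first : {A : Set} {P : A → Set} → Decidable P → A → List A → A
first P? d []       = d
first P? d (x ∷ xs) with P? x
... | yes _ = x
... | no  _ = first P? d xs

first-sat : {A : Set} {P : A → Set} (P? : Decidable P) {d : A} → P d → (xs : List A) → P (first P? d xs)
first-sat P? pd []       = pd
first-sat P? pd (x ∷ xs) with P? x
... | yes px = px
... | no  _  = first-sat P? pd xs

first-cong : {A : Set} {P Q : A → Set} (P? : Decidable P) (Q? : Decidable Q) →
  (∀ x → P x → Q x) → (∀ x → Q x → P x) → {d d' y : A} → P y →
  {xs : List A} → y ∈ xs → first P? d xs ≡ first Q? d' xs
first-cong P? Q? P⇒Q Q⇒P {y = y} py {x ∷ xs} y∈ with P? x | Q? x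
... | yes _  | yes _  = refl
... | yes px | no ¬qx = ⊥-elim (¬qx (P⇒Q x px))
... | no ¬px | yes qx = ⊥-elim (¬px (Q⇒P x qx))
... | no ¬px | no _ with y∈
...   | here refl = ⊥-elim (¬px py)
...   | there y∈xs = first-cong P? Q? P⇒Q Q⇒P py y∈xs

-- The enumerations are opaque: only their completeness is ever used, and
-- unfolding them during type checking would compute the (huge) lists.
opaque
  enum-Bool : Enumeration Bool
  enum-Bool = record { elements = false ∷ true ∷ [] ; complete = λ { false → here refl ; true → there (here refl) } }

  enum-Vec : {A : Set} → Enumeration A → (k : ℕ) → Enumeration (Vec A k)
  enum-Vec {A} E k = record { elements = vectors k ; complete = vectors-complete }
    where
    vectors : (k : ℕ) → List (Vec A k)
    vectors zero    = [] ∷ []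
    vectors (suc k) = cartesianProductWith _∷_ (elements E) (vectors k)
    vectors-complete : {k : ℕ} (v : Vec A k) → v ∈ vectors k
    vectors-complete []      = here refl
    vectors-complete (x ∷ v) = ∈-cartesianProductWith⁺ _∷_ (complete E x) (vectors-complete v)

  enum-Perm : (m : ℕ) → Enumeration (Perm m)
  enum-Perm m = record
    { elements = perms tablePairs
    ; complete = λ σ → perms-complete σ (∈-cartesianProduct⁺ (complete Tables (fwd σ)) (complete Tables (bwd σ))) }
    where
    Tables : Enumeration (Vec (Fin m) m)
    Tables = enum-Vec (record { elements = allFin m ; complete = ∈-allFin }) m
    tablePairs : List (Vec (Fin m) m × Vec (Fin m) m)
    tablePairs = cartesianProduct (elements Tables) (elements Tables)
    perms : List (Vec (Fin m) m × Vec (Fin m) m) → List (Perm m)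
    perms []              = []
    perms ((f , g) ∷ fgs) with inv? f g
    ... | yes fg = perm f g (fromWitness fg) ∷ perms fgs
    ... | no _   = perms fgs
    perms-complete : (σ : Perm m) {fgs : List (Vec (Fin m) m × Vec (Fin m) m)} →
      (fwd σ , bwd σ) ∈ fgs → σ ∈ perms fgs
    perms-complete σ {(f , g) ∷ fgs} σ∈ with inv? f g | σ∈
    ... | yes _  | here refl  = here (perm-ext λ _ → refl)
    ... | no ¬fg | here refl  = ⊥-elim (¬fg (toWitness (ok σ)))
    ... | yes _  | there σ∈′ = there (perms-complete σ σ∈′)
    ... | no _   | there σ∈′ = perms-complete σ σ∈′

  enum-GElt : (n h : ℕ) → Enumeration (GElt n h)
  enum-GElt n h = record
    { elements = map triple (cartesianProduct (elements (enum-Perm h)) (cartesianProduct (elements (enum-Perm n)) (elements enum-Bool)))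
    ; complete = λ (gelt φ ψ ρ) → ∈-map⁺ triple (∈-cartesianProduct⁺ (complete (enum-Perm h) φ)
                                      (∈-cartesianProduct⁺ (complete (enum-Perm n) ψ) (complete enum-Bool ρ))) }
    where
    triple : Perm h × Perm n × Bool → GElt n h
    triple (φ , ψ , ρ) = gelt φ ψ ρ

  enum-Profile : (n h : ℕ) → Enumeration (Profile n h)
  enum-Profile n h = enum-Vec (enum-Perm n) h

_≟ᴾ_ : {n h : ℕ} (p p' : Profile n h) → Dec (p ≡ p')
_≟ᴾ_ = ≡-dec _≟ₚ_

-- Two nonempty sets A, B of linear orders admit a ∈ A, b ∈ B with b ≠ σa, unless
-- A = {a} and B = σA.  This is where ρ₀-consistency of C gets used.
distinct-pair : {n : ℕ} (A B : LinOrd n → Bool) (σ : Perm n) →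
  (∃ λ a → a ∈C A) → (∃ λ b → b ∈C B) →
  (Singleton A → ¬ ((λ q → q ∈C B) ≐ imageBy σ A)) →
  Σ (Perm n × Perm n) λ (a , b) → a ∈C A × b ∈C B × b ≢ σ ∘ₚ a
distinct-pair {n} A B σ (a₀ , a₀∈A) (b₀ , b₀∈B) not-translate
  with search (enum-Perm n) (λ b → T? (B b) ×-dec ¬? (b ≟ₚ σ ∘ₚ a₀))
... | yes (b , b∈B , b≢σa₀) = (a₀ , b) , a₀∈A , b∈B , b≢σa₀
... | no no-b with search (enum-Perm n) (λ a → T? (A a) ×-dec ¬? (σ ∘ₚ a ≟ₚ b₀))
...   | yes (a , a∈A , σa≢b₀) = (a , b₀) , a∈A , b₀∈B , σa≢b₀ ∘ sym
...   | no no-a = ⊥-elim (not-translate (a₀ , a₀∈A , A-single) B≐σA)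
  where
  B⊆σa₀ : ∀ b → b ∈C B → b ≡ σ ∘ₚ a₀
  B⊆σa₀ b b∈B = decidable-stable (b ≟ₚ σ ∘ₚ a₀) λ b≢ → no-b (b , b∈B , b≢)
  σA⊆b₀ : ∀ a → a ∈C A → σ ∘ₚ a ≡ b₀
  σA⊆b₀ a a∈A = decidable-stable (σ ∘ₚ a ≟ₚ b₀) λ σa≢ → no-a (a , a∈A , σa≢)
  A-single : ∀ a → a ∈C A → a ≡ a₀
  A-single a a∈A = ∙-cancelˡ σ a a₀ (trans (σA⊆b₀ a a∈A) (sym (σA⊆b₀ a₀ a₀∈A)))
  B≐σA : (λ q → q ∈C B) ≐ imageBy σ A
  B≐σA q = (λ q∈B → a₀ , a₀∈A , B⊆σa₀ q q∈B)
         , λ { (a , a∈A , refl) → subst (λ b → b ∈C B) (sym (σA⊆b₀ a a∈A)) b₀∈B }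

selection : {n h : ℕ} → (Profile n h → LinOrd n) → SPC n h
selection f p q = ⌊ q ≟ₚ f p ⌋

module _ {n h : ℕ} (f : Profile n h → LinOrd n) where

  selection-resolute : Resolute (selection f)
  selection-resolute p = f p , fromWitness refl , λ q q∈ → toWitness q∈

  selection-refines : (C : SPC n h) → (∀ p → f p ∈C C p) → Refines (selection f) C
  selection-refines C f∈C p q q∈ = subst (λ q → q ∈C C p) (sym (toWitness q∈)) (f∈C p)

  selection-consistent : (U : GElt n h → Bool) →
    (∀ p g → T (U g) → ρ g ≡ false → f (act p g) ≡ ψ g ∘ₚ f p) →
    (∀ p g → T (U g) → ρ g ≡ true → f (act p g) ≢ ψ g ∘ₚ f p) →
    Consistent U (selection f)
  selection-consistent U even odd p g g∈U = even-case , odd-case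
    where
    even-case : ρ g ≡ false → (λ q → q ∈C selection f (act p g)) ≐ imageBy (ψ g) (selection f p)
    even-case ρg q = (λ q≡ → f p , fromWitness refl , trans (toWitness q≡) (even p g g∈U ρg))
                   , λ { (q' , q'≡ , refl) → fromWitness (trans (cong (ψ g ∘ₚ_) (toWitness q'≡))
                                                                (sym (even p g g∈U ρg))) }
    odd-case : ρ g ≡ true → Singleton (selection f p) →
               ¬ ((λ q → q ∈C selection f (act p g)) ≐ imageBy (ψ g) (selection f p))
    odd-case ρg _ same with proj₁ (same (f (act p g))) (fromWitness refl)
    ... | q' , q'≡ , eq = odd p g g∈U ρg (trans eq (cong (ψ g ∘ₚ_) (toWitness q'≡)))

module Construction {n h : ℕ} (n≥2 : n ≥ 2)
  (U : GElt n h → Bool) (U-subgroup : IsSubgroup U) (U-regular : Regular U)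
  (C : SPC n h) (C-decisive : Decisive C) (C-consistent : Consistent U C) where

  open IsSubgroup U-subgroup

  -- p' lies in the U-orbit of p.  A record rather than a Σ-type, so that its
  -- profiles are recovered by unification without unfolding the action.
  record Orbit (p p' : Profile n h) : Set where
    constructor orbit
    field
      element   : GElt n h
      element∈U : T (U element)
      carries   : act p element ≡ p'

  orbit? : (p p' : Profile n h) → Dec (Orbit p p')
  orbit? p p' = map′ (λ (g , g∈U , e) → orbit g g∈U e) (λ (orbit g g∈U e) → g , g∈U , e)
                     (search (enum-GElt n h) (λ g → T? (U g) ×-dec (act p g ≟ᴾ p')))

  orbit-sym : {p p' : Profile n h} → Orbit p p' → Orbit p' p
  orbit-sym {p} (orbit g g∈U refl) = orbit (invG g) (closed⁻ g g∈U) (act-inverse p g)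

  orbit-trans : {p p' p'' : Profile n h} → Orbit p p' → Orbit p' p'' → Orbit p p''
  orbit-trans {p} (orbit g g∈U refl) (orbit g' g'∈U refl) =
    orbit (g' ·G g) (closed· g' g g'∈U g∈U) (sym (act-act p g g'))

  rep : Profile n h → Profile n h
  rep p = first (orbit? p) p (elements (enum-Profile n h))

  rep-orbit : (p : Profile n h) → Orbit (rep p) p
  rep-orbit p = orbit-sym (first-sat (orbit? p) (orbit eG has-e (act-identity p)) (elements (enum-Profile n h)))

  rep-cong : {p p' : Profile n h} → Orbit p p' → rep p ≡ rep p'
  rep-cong {p} {p'} o = first-cong (orbit? p) (orbit? p')
    (λ _ → orbit-trans (orbit-sym o)) (λ _ → orbit-trans o)
    (orbit eG has-e (act-identity p)) (complete (enum-Profile n h) p)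

  ψ* : Profile n h → Perm n
  ψ* r = proj₁ (U-regular r)

  module _ (r : Profile n h) (z : GElt n h) (z∈U : T (U z)) (fixes : act r z ≡ r) where

    even-stabiliser : ρ z ≡ false → ψ z ≡ idₚ
    even-stabiliser ρz with proj₂ (proj₂ (U-regular r)) z z∈U fixes
    ... | inj₁ (ψz , _)  = ψz
    ... | inj₂ (_ , ρz′) = contradiction (trans (sym ρz′) ρz) λ ()

    odd-stabiliser : ρ z ≡ true → ψ z ≡ ψ* r
    odd-stabiliser ρz with proj₂ (proj₂ (U-regular r)) z z∈U fixes
    ... | inj₁ (_ , ρz′) = contradiction (trans (sym ρz′) ρz) λ ()
    ... | inj₂ (ψz , _)  = ψz

  ψ*-moves : (r : Profile n h) (q : LinOrd n) → ψ* r ∘ₚ q ≢ q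
  ψ*-moves r q ψ*q≡q = conj-ρ₀≢id n≥2 (proj₁ (proj₂ (U-regular r))) (fixes⇒id q ψ*q≡q)

  transport : (p : Profile n h) (g : GElt n h) (q : LinOrd n) {p' : Profile n h} →
    T (U g) → ρ g ≡ false → q ∈C C p → act p g ≡ p' → (ψ g ∘ₚ q) ∈C C p'
  transport p g q g∈U ρg q∈C refl =
    proj₂ (proj₁ (C-consistent p g g∈U) ρg (ψ g ∘ₚ q)) (q , q∈C , refl)

  -- An anchor at r: an order `even` ∈ C(r) for the even elements to transport, and
  -- an order `odd` for the odd ones, such that transporting never contradicts C,
  -- odd stabilisers of r swap the two, and the two differ.
  record Anchor (r : Profile n h) : Set where
    field
      even odd   : LinOrd n
      even∈C     : even ∈C C r
      odd∈C      : ∀ g → T (U g) → ρ g ≡ true → (ψ g ∘ₚ odd) ∈C C (act r g)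
      even≢odd   : even ≢ odd
      stabiliser-swaps : ∀ z → T (U z) → ρ z ≡ true → act r z ≡ r → ψ z ∘ₚ even ≡ odd

  order : {r : Profile n h} → Anchor r → Bool → LinOrd n
  order A b = if b then Anchor.odd A else Anchor.even A

  order-shift : {r : Profile n h} (A : Anchor r) (z : GElt n h) → T (U z) → act r z ≡ r →
    (b : Bool) → ψ z ∘ₚ order A b ≡ order A (ρ z xor b)
  order-shift {r} A z z∈U fixes b = shift (ρ z) b refl
    where
    open Anchor A using (even; odd; stabiliser-swaps)
    shift : (s b : Bool) → ρ z ≡ s → ψ z ∘ₚ order A b ≡ order A (s xor b)
    shift false b     ρz = trans (cong (_∘ₚ order A b) (even-stabiliser r z z∈U fixes ρz)) (∘ₚ-identityˡ _)
    shift true  false ρz = stabiliser-swaps z z∈U ρz fixes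
    shift true  true  ρz = begin
      ψ z ∘ₚ odd              ≡⟨ cong (ψ z ∘ₚ_) (stabiliser-swaps z z∈U ρz fixes) ⟨
      ψ z ∘ₚ ψ z ∘ₚ even      ≡⟨ ∘ₚ-assoc (ψ z) (ψ z) even ⟨
      ψ (z ·G z) ∘ₚ even      ≡⟨ cong (_∘ₚ even) (even-stabiliser r (z ·G z) (closed· z z z∈U z∈U) z²-fixes z²-even) ⟩
      idₚ ∘ₚ even             ≡⟨ ∘ₚ-identityˡ even ⟩
      even                    ∎
      where
      open ≡-Reasoning
      z²-fixes : act r (z ·G z) ≡ r
      z²-fixes = trans (sym (act-act r z z)) (trans (cong (λ p → act p z) fixes) fixes)
      z²-even : ρ (z ·G z) ≡ false
      z²-even = cong₂ _xor_ ρz ρz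

  -- Case 1: r has an odd stabiliser x₀; the odd order is ψ x₀ applied to the even one,
  -- which differs from it because ψ x₀ = ψ* r has no fixed point.
  anchor-at-odd-stabiliser : (r : Profile n h) (x₀ : GElt n h) →
    T (U x₀) → ρ x₀ ≡ true → act r x₀ ≡ r → Anchor r
  anchor-at-odd-stabiliser r x₀ x₀∈U ρx₀ fixes = record
    { even = a ; odd = ψ x₀ ∘ₚ a ; even∈C = a∈C
    ; odd∈C = λ g g∈U ρg → subst (λ q → q ∈C C (act r g)) (∘ₚ-assoc (ψ g) (ψ x₀) a)
        (transport r (g ·G x₀) a (closed· g x₀ g∈U x₀∈U) (cong₂ _xor_ ρg ρx₀) a∈C
          (trans (sym (act-act r x₀ g)) (cong (λ p → act p g) fixes)))
    ; even≢odd = λ a≡ψx₀a → ψ*-moves r a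
        (trans (cong (_∘ₚ a) (sym (odd-stabiliser r x₀ x₀∈U fixes ρx₀))) (sym a≡ψx₀a))
    ; stabiliser-swaps = λ z z∈U ρz z-fixes → cong (_∘ₚ a)
        (trans (odd-stabiliser r z z∈U z-fixes ρz) (sym (odd-stabiliser r x₀ x₀∈U fixes ρx₀)))
    }
    where
    a   = proj₁ (C-decisive r)
    a∈C = proj₂ (C-decisive r)

  -- Case 2: r has no odd stabiliser but U has an odd element t.  The ρ₀-half of
  -- U-consistency of C at (r, t) yields a ∈ C(r), b ∈ C(rᵗ) with b ≠ ψ t a.
  anchor-via-odd-element : (r : Profile n h) (t : GElt n h) → T (U t) → ρ t ≡ true →
    (∀ z → T (U z) → ρ z ≡ true → act r z ≢ r) → Anchor r
  anchor-via-odd-element r t t∈U ρt no-odd-stabiliser = from-pair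
    (distinct-pair (C r) (C (act r t)) (ψ t) (C-decisive r) (C-decisive (act r t))
                   (proj₂ (C-consistent r t t∈U) ρt))
    where
    from-pair : Σ (LinOrd n × LinOrd n) (λ (a , b) → a ∈C C r × b ∈C C (act r t) × b ≢ ψ t ∘ₚ a) →
                Anchor r
    from-pair ((a , b) , a∈C , b∈C , b≢ψta) = record
      { even = a ; odd = ψ t ⁻¹ₚ ∘ₚ b ; even∈C = a∈C
      ; odd∈C = λ g g∈U ρg → subst (λ q → q ∈C C (act r g)) (∘ₚ-assoc (ψ g) (ψ t ⁻¹ₚ) b)
          (transport (act r t) (g ·G invG t) b (closed· g (invG t) g∈U (closed⁻ t t∈U))
            (cong₂ _xor_ ρg ρt) b∈C
            (trans (sym (act-act (act r t) (invG t) g)) (cong (λ p → act p g) (act-inverse r t))))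
      ; even≢odd = λ a≡ → b≢ψta (trans (sym (\\-leftDividesˡ (ψ t) b)) (cong (ψ t ∘ₚ_) (sym a≡)))
      ; stabiliser-swaps = λ z z∈U ρz fixes → ⊥-elim (no-odd-stabiliser z z∈U ρz fixes)
      }

  -- Case 3: U has no odd element.
  anchor-without-odd-elements : (r : Profile n h) → (∀ g → T (U g) → ρ g ≢ true) → Anchor r
  anchor-without-odd-elements r no-odd = record
    { even = a ; odd = ρ₀ ∘ₚ a ; even∈C = proj₂ (C-decisive r)
    ; odd∈C = λ g g∈U ρg → ⊥-elim (no-odd g g∈U ρg)
    ; even≢odd = λ a≡ρ₀a → ρ₀≢id n≥2 (fixes⇒id a (sym a≡ρ₀a))
    ; stabiliser-swaps = λ z z∈U ρz _ → ⊥-elim (no-odd z z∈U ρz)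
    }
    where
    a = proj₁ (C-decisive r)

  anchor : (r : Profile n h) → Anchor r
  anchor r with search (enum-GElt n h) (λ z → T? (U z) ×-dec (ρ z ≟ᵇ true) ×-dec (act r z ≟ᴾ r))
  ... | yes (x₀ , x₀∈U , ρx₀ , fixes) = anchor-at-odd-stabiliser r x₀ x₀∈U ρx₀ fixes
  ... | no no-odd-stabiliser with search (enum-GElt n h) (λ t → T? (U t) ×-dec (ρ t ≟ᵇ true))
  ...   | yes (t , t∈U , ρt) = anchor-via-odd-element r t t∈U ρt
                                 λ z z∈U ρz fixes → no-odd-stabiliser (z , z∈U , ρz , fixes)
  ...   | no no-odd = anchor-without-odd-elements r λ g g∈U ρg → no-odd (g , g∈U , ρg)

  order-not : {r : Profile n h} (A : Anchor r) (b : Bool) → order A (not b) ≢ order A b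
  order-not A false odd≡even = Anchor.even≢odd A (sym odd≡even)
  order-not A true  = Anchor.even≢odd A

  carried : {r : Profile n h} → Anchor r → GElt n h → LinOrd n
  carried A g = ψ g ∘ₚ order A (ρ g)

  carried∈C : (r : Profile n h) (A : Anchor r) (g : GElt n h) → T (U g) → carried A g ∈C C (act r g)
  carried∈C r A g g∈U = by-sign (ρ g) refl
    where
    by-sign : (s : Bool) → ρ g ≡ s → (ψ g ∘ₚ order A s) ∈C C (act r g)
    by-sign false ρg = transport r g (Anchor.even A) g∈U ρg (Anchor.even∈C A) refl
    by-sign true  ρg = Anchor.odd∈C A g g∈U ρg

  carried-indep : (r : Profile n h) (A : Anchor r) (g g' : GElt n h) → T (U g) → T (U g') →
    act r g ≡ act r g' → carried A g ≡ carried A g'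
  carried-indep r A g g' g∈U g'∈U same = begin
    ψ g ∘ₚ order A (ρ g)                     ≡⟨ cong (_∘ₚ order A (ρ g)) (\\-leftDividesˡ (ψ g') (ψ g)) ⟨
    (ψ g' ∘ₚ ψ z) ∘ₚ order A (ρ g)            ≡⟨ ∘ₚ-assoc (ψ g') (ψ z) _ ⟩
    ψ g' ∘ₚ ψ z ∘ₚ order A (ρ g)              ≡⟨ cong (ψ g' ∘ₚ_) (order-shift A z z∈U fixes (ρ g)) ⟩
    ψ g' ∘ₚ order A ((ρ g' xor ρ g) xor ρ g)  ≡⟨ cong (λ s → ψ g' ∘ₚ order A s) (xor-cancelʳ (ρ g') (ρ g)) ⟩
    ψ g' ∘ₚ order A (ρ g')                    ∎
    where
    open ≡-Reasoning
    z : GElt n h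
    z = invG g' ·G g
    z∈U : T (U z)
    z∈U = closed· (invG g') g (closed⁻ g' g'∈U) g∈U
    fixes : act r z ≡ r
    fixes = trans (sym (act-act r g (invG g'))) (trans (cong (λ p → act p (invG g')) same) (act-inverse r g'))
    xor-cancelʳ : (a b : Bool) → (a xor b) xor b ≡ a
    xor-cancelʳ a b = trans (xor-assoc a b b) (trans (cong (a xor_) (xor-same b)) (xor-identityʳ a))

  select : Profile n h → LinOrd n
  select p = carried (anchor (rep p)) (Orbit.element (rep-orbit p))

  select-by : (p r : Profile n h) → rep p ≡ r → (g : GElt n h) → T (U g) → act r g ≡ p →
    select p ≡ carried (anchor r) g
  select-by p _ refl g g∈U g-carries =
    carried-indep (rep p) (anchor (rep p)) _ g element∈U g∈U (trans carries (sym g-carries))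
    where open Orbit (rep-orbit p)

  select∈C : (p : Profile n h) → select p ∈C C p
  select∈C p = subst (λ p' → select p ∈C C p') carries (carried∈C (rep p) (anchor (rep p)) element element∈U)
    where open Orbit (rep-orbit p)

  select-act : (p : Profile n h) (k : GElt n h) → T (U k) →
    let g = Orbit.element (rep-orbit p) in
    select (act p k) ≡ ψ k ∘ₚ ψ g ∘ₚ order (anchor (rep p)) (ρ k xor ρ g)
  select-act p k k∈U = trans
    (select-by (act p k) (rep p) (sym (rep-cong {p} {act p k} (orbit k k∈U refl)))
               (k ·G element) (closed· k element k∈U element∈U)
               (trans (sym (act-act (rep p) element k)) (cong (λ q → act q k) carries)))
    (∘ₚ-assoc (ψ k) (ψ element) _)
    where open Orbit (rep-orbit p)

  select-even : ∀ p k → T (U k) → ρ k ≡ false → select (act p k) ≡ ψ k ∘ₚ select p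
  select-even p k k∈U ρk =
    trans (select-act p k k∈U) (cong (λ s → ψ k ∘ₚ ψ element ∘ₚ order (anchor (rep p)) (s xor ρ element)) ρk)
    where open Orbit (rep-orbit p)

  select-odd : ∀ p k → T (U k) → ρ k ≡ true → select (act p k) ≢ ψ k ∘ₚ select p
  select-odd p k k∈U ρk same = order-not (anchor (rep p)) (ρ element)
    (∙-cancelˡ (ψ element) _ _ (∙-cancelˡ (ψ k) _ _ (trans (sym odd-shift) same)))
    where
    open Orbit (rep-orbit p)
    odd-shift : select (act p k) ≡ ψ k ∘ₚ ψ element ∘ₚ order (anchor (rep p)) (not (ρ element))
    odd-shift = trans (select-act p k k∈U)
      (cong (λ s → ψ k ∘ₚ ψ element ∘ₚ order (anchor (rep p)) (s xor ρ element)) ρk)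

theorem9 : (n h : ℕ) → n ≥ 2 → h ≥ 2 →
    (U : GElt n h → Bool) → IsSubgroup U → Regular U →
    (C : SPC n h) → Decisive C → Consistent U C →
    Σ (SPC n h) λ C' → Resolute C' × Refines C' C × Consistent U C'
theorem9 n h n≥2 _ U U-subgroup U-regular C C-decisive C-consistent =
    selection select
  , selection-resolute select
  , selection-refines select C select∈C
  , selection-consistent select U select-even select-odd
  where open Construction n≥2 U U-subgroup U-regular C C-decisive C-consistent
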